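{- Let $G$ be a graph and $C$ a hole of $G$ such that no vertex outside $C$ has two neighbours in $C$. Assume that $G$ has no vertex of degree $2$ and has neither a $K_1$-cut nor a $K_2$-cut. Then for every $3$-vertex path $xyz$ contained in $C$, at least one of the following holds: (1) $x$ or $z$ is an end of a short jump over $C$; (2) there is a local $(x,z)$-jump over $C$ across $y$; (3) $y$ is an end of a short jump over $C$, or of a local jump over $C$ across one vertex.
   Context: A hole is an induced cycle of length at least four. A $K_1$-cut (resp. $K_2$-cut) is a single vertex (resp. the two ends of an edge) whose removal disconnects $G$. For a hole $C$ and non-adjacent $s,t\in V(C)$, an $(s,t)$-jump over $C$ is an induced $(s,t)$-path $P$ none of whose internal vertices lies in $C$; its ends are $s,t$. Let $Q_1,Q_2$ be the two $(s,t)$-paths of $C$, with sets of internal vertices $Q_1^*,Q_2^*$, and let $P^*$ be the set of internal vertices of $P$. Two vertex sets are anti-complete if no edge joins them. $P$ is a short jump if $Q_1^*\cup Q_2^*$ is anti-complete to $P^*$. $P$ is a local jump across $Q_1^*$ if $Q_1^*$ is not anti-complete to $P^*$ while $Q_2^*$ is anti-complete to $P^*$; it is a local jump across one vertex $y$ if moreover $Q_1^*=\{y\}$. -}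

module Defs where

open import Data.Nat using (ℕ; zero; suc; _<_; _≤_)
open import Data.Fin using (Fin; toℕ; fromℕ)
open import Data.Bool using (Bool; true; false; not)
import Data.Bool as B
open import Data.List using (List; length; filter; allFin)
open import Data.Product using (Σ; ∃; _×_; _,_)
open import Data.Sum using (_⊎_)
open import Relation.Nullary using (¬_)
open import Relation.Binary.PropositionalEquality using (_≡_; _≢_)
open import Function.Bundles using (_⇔_)

record Graph (n : ℕ) : Set where
  field
    adj        : Fin n → Fin n → Bool
    adj-sym    : ∀ u v → adj u v ≡ adj v u
    adj-irrefl : ∀ v → adj v v ≡ false

module _ {n : ℕ} (G : Graph n) where
  open Graph G

  Adj : Fin n → Fin n → Set
  Adj u v = adj u v ≡ true

  degree : Fin n → ℕ
  degree v = length (filter (λ u → adj v u B.≟ true) (allFin n))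

  data Reach (X : Fin n → Set) (u : Fin n) : Fin n → Set where
    here : ¬ X u → Reach X u u
    step : ∀ {v w} → Reach X u v → ¬ X w → Adj v w → Reach X u w

  DisconnectedWithout : (Fin n → Set) → Set
  DisconnectedWithout X =
    Σ (Fin n) λ u → Σ (Fin n) λ v → ¬ X u × ¬ X v × ¬ Reach X u v

  K1Cut : Fin n → Set
  K1Cut v = DisconnectedWithout (λ w → w ≡ v)

  K2Cut : Fin n → Fin n → Set
  K2Cut u v = Adj u v × DisconnectedWithout (λ w → w ≡ u ⊎ w ≡ v)

  AntiComplete : (Fin n → Set) → (Fin n → Set) → Set
  AntiComplete A B = ∀ u v → A u → B v → ¬ Adj u v

  IsInducedPath : {len : ℕ} → (Fin (suc len) → Fin n) → Set
  IsInducedPath p =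
    (∀ a b → p a ≡ p b → a ≡ b) ×
    (∀ a b → Adj (p a) (p b) ⇔ (toℕ b ≡ suc (toℕ a) ⊎ toℕ a ≡ suc (toℕ b)))

  CycNext : {k : ℕ} → Fin k → Fin k → Set
  CycNext {k} i j = toℕ j ≡ suc (toℕ i) ⊎ (suc (toℕ i) ≡ k × toℕ j ≡ 0)

  CycAdj : {k : ℕ} → Fin k → Fin k → Set
  CycAdj i j = CycNext i j ⊎ CycNext j i

  IsHole : (k : ℕ) → (Fin k → Fin n) → Set
  IsHole k c =
    4 ≤ k ×
    (∀ i j → c i ≡ c j → i ≡ j) ×
    (∀ i j → Adj (c i) (c j) ⇔ CycAdj i j)

  OnHole : {k : ℕ} → (Fin k → Fin n) → Fin n → Set
  OnHole {k} c v = Σ (Fin k) λ m → c m ≡ v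

  -- The two (c i, c j)-paths of C split the positions of C - {c i, c j}:
  -- side true = positions strictly between i and j,
  -- side false = positions outside the closed interval between i and j.
  ArcPos : {k : ℕ} → Bool → Fin k → Fin k → Fin k → Set
  ArcPos true  i j m = (toℕ i < toℕ m × toℕ m < toℕ j) ⊎ (toℕ j < toℕ m × toℕ m < toℕ i)
  ArcPos false i j m = (toℕ m < toℕ i × toℕ m < toℕ j) ⊎ (toℕ i < toℕ m × toℕ j < toℕ m)

  ArcInt : {k : ℕ} → (Fin k → Fin n) → Bool → Fin k → Fin k → Fin n → Set
  ArcInt {k} c side i j v = Σ (Fin k) λ m → ArcPos side i j m × c m ≡ v

  PathInt : {len : ℕ} → (Fin (suc len) → Fin n) → Fin n → Set
  PathInt {len} p v = Σ (Fin (suc len)) λ a → 0 < toℕ a × toℕ a < len × p a ≡ v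

  IsJump : {k len : ℕ} → (Fin k → Fin n) → Fin k → Fin k → (Fin (suc len) → Fin n) → Set
  IsJump {k} {len} c i j p =
    i ≢ j × ¬ Adj (c i) (c j) ×
    IsInducedPath p ×
    p Data.Fin.zero ≡ c i × p (fromℕ len) ≡ c j ×
    (∀ v → PathInt p v → ¬ OnHole c v)

  IsShort : {k len : ℕ} → (Fin k → Fin n) → Fin k → Fin k → (Fin (suc len) → Fin n) → Set
  IsShort c i j p =
    AntiComplete (ArcInt c true i j) (PathInt p) ×
    AntiComplete (ArcInt c false i j) (PathInt p)

  IsLocalAcross : {k len : ℕ} → (Fin k → Fin n) → Bool → Fin k → Fin k →
                  (Fin (suc len) → Fin n) → Set
  IsLocalAcross c side i j p =
    ¬ AntiComplete (ArcInt c side i j) (PathInt p) ×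
    AntiComplete (ArcInt c (not side) i j) (PathInt p)

  IsLocalAcrossVertex : {k len : ℕ} → (Fin k → Fin n) → Fin n → Fin k → Fin k →
                        (Fin (suc len) → Fin n) → Set
  IsLocalAcrossVertex c y i j p =
    Σ Bool λ side → (∀ v → ArcInt c side i j v ⇔ v ≡ y) × IsLocalAcross c side i j p

  EndOfJumpWith : {k : ℕ} → (Fin k → Fin n) → Fin k →
                  (∀ {len} → Fin k → Fin k → (Fin (suc len) → Fin n) → Set) → Set
  EndOfJumpWith {k} c e Prop =
    Σ (Fin k) λ i → Σ (Fin k) λ j → Σ ℕ λ len → Σ (Fin (suc len) → Fin n) λ p →
      (i ≡ e ⊎ j ≡ e) × IsJump c i j p × Prop i j p

{-# OPTIONS --safe #-}
module Submission where

-- Since y has degree at least three, it has a neighbour w off the hole C. If every vertex reachable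
-- from w in G − V(C) sees only x, y, z on C, then, as neither {x, y} nor {y, z} is a K₂-cut, this
-- component sees both x and z and yields an (x, z)-jump whose interior sees only x, y and z; as y is
-- the only internal vertex of one (x, z)-arc, that jump is short or local across y. Otherwise a walk
-- from w escapes to a vertex seeing some u ∉ {x, y, z}. The last vertex before it that sees C sees
-- exactly one a ∈ {x, y, z}, which gives a short (a, u)-jump unless a is adjacent to u on C; then
-- either an earlier vertex of the walk sees the other end of xyz, giving an (x, z)-jump as before,
-- or the whole walk gives a (y, u)-jump that is short or local across a. Jumps are obtained from
-- walks by shortcutting them to induced paths.

open import Defs
open import Level using (0ℓ)
open import Data.Nat as ℕ using (ℕ; zero; suc; z≤n; s≤s)
import Data.Nat.Properties as ℕ
open import Data.Fin as Fin using (Fin; toℕ; fromℕ)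
import Data.Fin.Properties as Fin
open import Data.Bool using (Bool; true; false; not)
import Data.Bool as Bool
open import Data.List using (List; []; _∷_; _++_; length; lookup; filter; allFin)
import Data.List.Properties as List
open import Data.List.Relation.Unary.All as All using (All; []; _∷_)
open import Data.List.Relation.Unary.All.Properties using (¬Any⇒All¬; All¬⇒¬Any; ++⁻ˡ; ++⁻ʳ)
open import Data.List.Relation.Unary.Any as Any using (Any; here; there)
import Data.List.Relation.Unary.AllPairs as AllPairs
open import Data.List.Relation.Unary.Unique.Propositional using (Unique)
open import Data.List.Relation.Unary.Unique.Propositional.Properties using (filter⁺; allFin⁺)
open import Data.List.Membership.Propositional using (_∈_; _∉_; find)
open import Data.List.Membership.Propositional.Properties using (∈-filter⁺; ∈-filter⁻; ∈-allFin; ∈-lookup)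
open import Data.List.Membership.Propositional.Properties.WithK using (unique∧set⇒bag)
open import Data.List.Relation.Binary.BagAndSetEquality using (_∼[_]_; set; ∼bag⇒↭)
open import Data.List.Relation.Binary.Permutation.Propositional.Properties using (↭-length)
open import Data.Product as Product using (Σ; _×_; _,_; proj₁; proj₂; uncurry′)
open import Data.Sum as Sum using (_⊎_; inj₁; inj₂; [_,_])
open import Data.Unit using (⊤; tt)
open import Data.Empty using (⊥; ⊥-elim)
open import Function using (_∘_; case_of_)
open import Function.Bundles using (_⇔_; mk⇔; Equivalence)
open import Relation.Nullary using (¬_; Dec; yes; no)
open import Relation.Nullary.Decidable using (_×-dec_; _⊎-dec_; ¬?; map′; decidable-stable)
open import Relation.Unary using (Pred; Decidable; _⊆_; _∪_)
open import Relation.Binary.PropositionalEquality using (_≡_; _≢_; refl; sym; trans; cong; subst; ≢-sym)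

module Walks {n : ℕ} (G : Graph n) where
  open Graph G
  open import Data.List.Membership.DecPropositional (Fin._≟_ {n}) using (_∈?_)

  Adj? : ∀ u v → Dec (Adj G u v)
  Adj? u v = adj u v Bool.≟ true

  Adj-sym : ∀ {u v} → Adj G u v → Adj G v u
  Adj-sym {u} {v} uv = trans (adj-sym v u) uv

  Adj⇒≢ : ∀ {u v} → Adj G u v → u ≢ v
  Adj⇒≢ {u} uu refl with trans (sym uu) (adj-irrefl u)
  ... | ()

  module _ {X : Pred (Fin n) 0ℓ} where

    start-allowed : ∀ {u v} → Reach G X u v → ¬ X u
    start-allowed (here ¬Xu)   = ¬Xu
    start-allowed (step r _ _) = start-allowed r

    end-allowed : ∀ {u v} → Reach G X u v → ¬ X v
    end-allowed (here ¬Xv)    = ¬Xv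
    end-allowed (step _ ¬Xv _) = ¬Xv

    prepend : ∀ {a u v} → Adj G a u → ¬ X a → Reach G X u v → Reach G X a v
    prepend au ¬Xa (here ¬Xu)     = step (here ¬Xa) ¬Xu au
    prepend au ¬Xa (step r ¬Xw vw) = step (prepend au ¬Xa r) ¬Xw vw

    reverse : ∀ {u v} → Reach G X u v → Reach G X v u
    reverse (here ¬Xu)     = here ¬Xu
    reverse (step r ¬Xw vw) = prepend (Adj-sym vw) ¬Xw (reverse r)

    concat : ∀ {u v w} → Reach G X u v → Reach G X v w → Reach G X u w
    concat r (here _)        = r
    concat r (step s ¬Xw vw) = step (concat r s) ¬Xw vw

  relax : ∀ {X Y : Pred (Fin n) 0ℓ} {u v} → Y ⊆ X → Reach G X u v → Reach G Y u v
  relax Y⊆X (here ¬Xu)     = here (λ Yu → ¬Xu (Y⊆X Yu))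
  relax Y⊆X (step r ¬Xw vw) = step (relax Y⊆X r) (λ Yw → ¬Xw (Y⊆X Yw)) vw

  firstEntry : ∀ {X H : Pred (Fin n) 0ℓ} {u v} → Decidable H → ¬ H u → Reach G X u v →
               Reach G (X ∪ H) u v ⊎
               Σ (Fin n) λ a → Σ (Fin n) λ b → Reach G (X ∪ H) u a × Adj G a b × H b × ¬ X b
  firstEntry H? ¬Hu (here ¬Xu) = inj₁ (here [ ¬Xu , ¬Hu ])
  firstEntry H? ¬Hu (step {v} {w} r ¬Xw vw) with firstEntry H? ¬Hu r
  ... | inj₂ entry = inj₂ entry
  ... | inj₁ r′ with H? w
  ...   | yes Hw  = inj₂ (v , w , r′ , vw , Hw , ¬Xw)
  ...   | no  ¬Hw = inj₁ (step r′ [ ¬Xw , ¬Hw ] vw)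

  leaveStart : ∀ {X : Pred (Fin n) 0ℓ} {u v} → Reach G X u v → u ≢ v →
               Σ (Fin n) λ a → Adj G u a × ¬ X a × Reach G (X ∪ (_≡ u)) a v
  leaveStart (here _) u≢v = ⊥-elim (u≢v refl)
  leaveStart {u = u} (step {v′} {w} r ¬Xw v′w) u≢w with v′ Fin.≟ u
  ... | yes refl = w , v′w , ¬Xw , here [ ¬Xw , ≢-sym u≢w ]
  ... | no v′≢u with leaveStart r (≢-sym v′≢u)
  ...   | a , ua , ¬Xa , r′ = a , ua , ¬Xa , step r′ [ ¬Xw , ≢-sym u≢w ] v′w

  private
    remove : Fin n → List (Fin n) → List (Fin n)
    remove u = filter (λ e → ¬? (e Fin.≟ u))

    -- A walk inside L from u to v ≢ u is an edge u a followed by a walk inside L without u.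
    reachWithin? : ∀ fuel (L : List (Fin n)) → length L ℕ.< fuel →
                   ∀ u v → Dec (Reach G (_∉ L) u v)
    reachWithin? (suc fuel) L (s≤s |L|≤fuel) u v with u ∈? L
    ... | no u∉L = no (λ r → start-allowed r u∉L)
    ... | yes u∈L with u Fin.≟ v
    ...   | yes refl = yes (here (λ u∉L → u∉L u∈L))
    ...   | no u≢v with Fin.any? (λ a → Adj? u a ×-dec ((a ∈? remove u L) ×-dec
                                    reachWithin? fuel (remove u L) shorter a v))
      where
      shorter : length (remove u L) ℕ.< fuel
      shorter = ℕ.<-≤-trans (List.filter-notAll _ L (Any.map (λ { refl u≢u → u≢u refl }) u∈L)) |L|≤fuel
    ... | yes (a , ua , _ , r) = yes (prepend ua (λ u∉L → u∉L u∈L) (relax kept r))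
      where
      kept : (_∉ L) ⊆ (_∉ remove u L)
      kept e∉L e∈ = e∉L (proj₁ (∈-filter⁻ _ e∈))
    ... | no ¬next = no λ r → let a , ua , ¬a∉L , r′ = leaveStart r u≢v in
                     ¬next (a , ua , ∈-filter⁺ _ (decidable-stable (a ∈? L) ¬a∉L) (≢-sym (Adj⇒≢ ua)) ,
                            relax outside r′)
      where
      outside : (_∉ remove u L) ⊆ ((_∉ L) ∪ (_≡ u))
      outside {e} e∉ with e Fin.≟ u | e ∈? L
      ... | yes e≡u | _       = inj₂ e≡u
      ... | no  e≢u | yes e∈L = ⊥-elim (e∉ (∈-filter⁺ _ e∈L e≢u))
      ... | no  _   | no  e∉L = inj₁ e∉L

  reach? : ∀ {X : Pred (Fin n) 0ℓ} → Decidable X → ∀ u v → Dec (Reach G X u v)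
  reach? {X} X? u v = map′ (relax outside) (relax inside) (reachWithin? _ allowed ℕ.≤-refl u v)
    where
    allowed : List (Fin n)
    allowed = filter (¬? ∘ X?) (allFin n)
    outside : X ⊆ (_∉ allowed)
    outside Xe e∈ = proj₂ (∈-filter⁻ (¬? ∘ X?) {xs = allFin n} e∈) Xe
    inside : (_∉ allowed) ⊆ X
    inside {e} e∉ = decidable-stable (X? e) (e∉ ∘ ∈-filter⁺ (¬? ∘ X?) (∈-allFin e))

module InducedPaths {n : ℕ} (G : Graph n) where
  open Walks G

  AdjHead : Fin n → List (Fin n) → Set
  AdjHead a []      = ⊤
  AdjHead a (b ∷ _) = Adj G a b

  NonAdjAfterHead : Fin n → List (Fin n) → Set
  NonAdjAfterHead a []       = ⊤
  NonAdjAfterHead a (_ ∷ bs) = All (¬_ ∘ Adj G a) bs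

  Induced : List (Fin n) → Set
  Induced []       = ⊤
  Induced (a ∷ as) = AdjHead a as × All (a ≢_) as × NonAdjAfterHead a as × Induced as

  data EndsAt : List (Fin n) → Fin n → Set where
    single : ∀ {v} → EndsAt (v ∷ []) v
    cons   : ∀ {a b bs v} → EndsAt (b ∷ bs) v → EndsAt (a ∷ b ∷ bs) v

  EndsAt⇒∷ʳ : ∀ {as v} → EndsAt as v → Σ (List (Fin n)) λ init → as ≡ init ++ v ∷ []
  EndsAt⇒∷ʳ single = [] , refl
  EndsAt⇒∷ʳ (cons {a} e) = let init , eq = EndsAt⇒∷ʳ e in a ∷ init , cong (a ∷_) eq

  -- Cutting at the first vertex equal or adjacent to w keeps the path induced.
  shortcut : Fin n → List (Fin n) → Fin n → List (Fin n)
  shortcut a []       w = w ∷ []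
  shortcut a (b ∷ bs) w with a Fin.≟ w | Adj? a w
  ... | yes _ | _     = []
  ... | no _  | yes _ = w ∷ []
  ... | no _  | no _  = b ∷ shortcut b bs w

  All-shortcut : ∀ {P : Fin n → Set} a as w → All P as → P w → All P (shortcut a as w)
  All-shortcut a []       w _          Pw = Pw ∷ []
  All-shortcut a (b ∷ bs) w (Pb ∷ Pbs) Pw with a Fin.≟ w | Adj? a w
  ... | yes _ | _     = []
  ... | no _  | yes _ = Pw ∷ []
  ... | no _  | no _  = Pb ∷ All-shortcut b bs w Pbs Pw

  shortcut-induced : ∀ a as {v w} → Induced (a ∷ as) → EndsAt (a ∷ as) v → Adj G v w →
                     Induced (a ∷ shortcut a as w) × EndsAt (a ∷ shortcut a as w) w
  shortcut-induced a [] _ single aw = (aw , Adj⇒≢ aw ∷ [] , [] , tt , [] , tt , tt) , cons single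
  shortcut-induced a (b ∷ bs) {w = w} (ab , a≢ , far , ind) (cons e) vw with a Fin.≟ w | Adj? a w
  ... | yes refl | _      = (tt , [] , tt , tt) , single
  ... | no a≢w   | yes aw = (aw , a≢w ∷ [] , [] , tt , [] , tt , tt) , cons single
  ... | no a≢w   | no ¬aw =
    let ind′ , e′ = shortcut-induced b bs ind e vw in
    (ab , All.head a≢ ∷ All-shortcut b bs w (All.tail a≢) a≢w , All-shortcut b bs w far ¬aw , ind′) , cons e′

  private
    inducedPathOf : ∀ {X u v} → Reach G X u v →
                    Σ (List (Fin n)) λ as → Induced (u ∷ as) × EndsAt (u ∷ as) v × All (¬_ ∘ X) (u ∷ as)
    inducedPathOf (here ¬Xu) = [] , (tt , [] , tt , tt) , single , ¬Xu ∷ []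
    inducedPathOf {u = u} (step {w = w} r ¬Xw vw) =
      let as , ind , e , ¬X∷ = inducedPathOf r
          ind′ , e′ = shortcut-induced u as ind e vw in
      shortcut u as w , ind′ , e′ , All.head ¬X∷ ∷ All-shortcut u as w (All.tail ¬X∷) ¬Xw

  inducedPath : ∀ {X u v} → Reach G X u v → u ≢ v →
                Σ (List (Fin n)) λ mid → Induced (u ∷ mid ++ v ∷ []) × All (¬_ ∘ X) mid
  inducedPath r u≢v with inducedPathOf r
  ... | [] , _ , single , _ = ⊥-elim (u≢v refl)
  ... | _ ∷ _ , ind , cons e , _ ∷ ¬X∷ =
    let mid , eq = EndsAt⇒∷ʳ e in
    mid , subst (Induced ∘ (_ ∷_)) eq ind , ++⁻ˡ mid (subst (All _) eq ¬X∷)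

  interior-≢ends : ∀ {u mid v} → Induced (u ∷ mid ++ v ∷ []) → All (λ e → e ≢ u × e ≢ v) mid
  interior-≢ends {mid = mid} (_ , u≢ , _ , ind) =
    All.zip (All.map ≢-sym (++⁻ˡ mid u≢) , ≢last mid ind)
    where
    ≢last : ∀ {v} as → Induced (as ++ v ∷ []) → All (_≢ v) as
    ≢last []       _                = []
    ≢last (a ∷ as) (_ , a≢ , _ , ind) = All.head (++⁻ʳ as a≢) ∷ ≢last as ind

  Consecutive : ∀ {m} → Fin m → Fin m → Set
  Consecutive i j = toℕ j ≡ suc (toℕ i) ⊎ toℕ i ≡ suc (toℕ j)

  lookup-injective : ∀ {as} → Induced as → ∀ i j → lookup as i ≡ lookup as j → i ≡ j
  lookup-injective {_ ∷ _} _                 Fin.zero    Fin.zero    _  = refl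
  lookup-injective {_ ∷ _} (_ , a≢ , _ , _)  Fin.zero    (Fin.suc j) eq = ⊥-elim (All.lookup a≢ (∈-lookup j) eq)
  lookup-injective {_ ∷ _} (_ , a≢ , _ , _)  (Fin.suc i) Fin.zero    eq = ⊥-elim (All.lookup a≢ (∈-lookup i) (sym eq))
  lookup-injective {_ ∷ _} (_ , _ , _ , ind) (Fin.suc i) (Fin.suc j) eq = cong Fin.suc (lookup-injective ind i j eq)

  adj-head⇔consecutive : ∀ {a as} → Induced (a ∷ as) → ∀ j →
                         Adj G a (lookup as j) ⇔ Consecutive Fin.zero (Fin.suc j)
  adj-head⇔consecutive {as = b ∷ bs} (ab , _ , _ , _) Fin.zero = mk⇔ (λ _ → inj₁ refl) (λ _ → ab)
  adj-head⇔consecutive {as = b ∷ bs} (_ , _ , far , _) (Fin.suc j) =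
    mk⇔ (λ aj → ⊥-elim (All.lookup far (∈-lookup j) aj)) (λ { (inj₁ ()) ; (inj₂ ()) })

  adj⇔consecutive : ∀ {as} → Induced as → ∀ i j → Adj G (lookup as i) (lookup as j) ⇔ Consecutive i j
  adj⇔consecutive {a ∷ as} ind Fin.zero Fin.zero =
    mk⇔ (λ aa → ⊥-elim (Adj⇒≢ aa refl)) (λ { (inj₁ ()) ; (inj₂ ()) })
  adj⇔consecutive {a ∷ as} ind Fin.zero (Fin.suc j) = adj-head⇔consecutive ind j
  adj⇔consecutive {a ∷ as} ind (Fin.suc i) Fin.zero =
    mk⇔ (Sum.swap ∘ to ∘ Adj-sym) (Adj-sym ∘ from ∘ Sum.swap)
    where open Equivalence (adj-head⇔consecutive ind i)
  adj⇔consecutive {a ∷ as} (_ , _ , _ , ind) (Fin.suc i) (Fin.suc j) =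
    mk⇔ (Sum.map (cong suc) (cong suc) ∘ to) (from ∘ Sum.map ℕ.suc-injective ℕ.suc-injective)
    where open Equivalence (adj⇔consecutive ind i j)

  Induced⇒IsInducedPath : ∀ {a as} → Induced (a ∷ as) → IsInducedPath G (lookup (a ∷ as))
  Induced⇒IsInducedPath ind = lookup-injective ind , adj⇔consecutive ind

  lookup-last : ∀ (s : Fin n) mid t → lookup (s ∷ mid ++ t ∷ []) (fromℕ (length (mid ++ t ∷ []))) ≡ t
  lookup-last s []      t = refl
  lookup-last s (b ∷ mid) t = lookup-last b mid t

  private
    lookup-init : ∀ mid (t : Fin n) (a : Fin (length (mid ++ t ∷ []))) → suc (toℕ a) ℕ.< length (mid ++ t ∷ []) →
                  lookup (mid ++ t ∷ []) a ∈ mid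
    lookup-init []        t Fin.zero    (s≤s ())
    lookup-init (b ∷ mid) t Fin.zero    _        = here refl
    lookup-init (b ∷ mid) t (Fin.suc a) (s≤s lt) = there (lookup-init mid t a lt)

    index-init : ∀ mid (t : Fin n) {v} → v ∈ mid →
                 Σ (Fin (length (mid ++ t ∷ []))) λ a →
                   suc (toℕ a) ℕ.< length (mid ++ t ∷ []) × lookup (mid ++ t ∷ []) a ≡ v
    index-init (b ∷ [])      t (here refl) = Fin.zero , s≤s (s≤s z≤n) , refl
    index-init (b ∷ c ∷ mid) t (here refl) = Fin.zero , s≤s (s≤s z≤n) , refl
    index-init (b ∷ mid)     t (there v∈) = let a , lt , eq = index-init mid t v∈ in Fin.suc a , s≤s lt , eq

  PathInt⇔∈ : ∀ (s : Fin n) mid t v → PathInt G (lookup (s ∷ mid ++ t ∷ [])) v ⇔ v ∈ mid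
  PathInt⇔∈ s mid t v = mk⇔ to from
    where
    to : PathInt G (lookup (s ∷ mid ++ t ∷ [])) v → v ∈ mid
    to (Fin.suc a , _ , lt , refl) = lookup-init mid t a lt
    from : v ∈ mid → PathInt G (lookup (s ∷ mid ++ t ∷ [])) v
    from v∈ = let a , lt , eq = index-init mid t v∈ in Fin.suc a , s≤s z≤n , lt , eq

module Cycle {n : ℕ} (G : Graph n) {k : ℕ} (k≥4 : 4 ℕ.≤ k) where

  Next : Fin k → Fin k → Set
  Next = CycNext G

  Arc : Bool → Fin k → Fin k → Fin k → Set
  Arc = ArcPos G

  private
    k≢ : ∀ {m} → k ≡ m → m ℕ.< 4 → ⊥
    k≢ refl m<4 = ℕ.<-irrefl refl (ℕ.<-≤-trans m<4 k≥4)

  CycAdj-sym : ∀ {i j : Fin k} → CycAdj G i j → CycAdj G j i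
  CycAdj-sym = Sum.swap

  Next-functional : ∀ {i j j′} → Next i j → Next i j′ → j ≡ j′
  Next-functional (inj₁ e)       (inj₁ e′)      = Fin.toℕ-injective (trans e (sym e′))
  Next-functional {j = j} (inj₁ e) (inj₂ (e′ , _)) = ⊥-elim (ℕ.<-irrefl (trans e e′) (Fin.toℕ<n j))
  Next-functional {j′ = j′} (inj₂ (e , _)) (inj₁ e′) = ⊥-elim (ℕ.<-irrefl (trans e′ e) (Fin.toℕ<n j′))
  Next-functional (inj₂ (_ , e)) (inj₂ (_ , e′)) = Fin.toℕ-injective (trans e (sym e′))

  Next-injective : ∀ {i i′ j} → Next i j → Next i′ j → i ≡ i′
  Next-injective (inj₁ e)       (inj₁ e′)      = Fin.toℕ-injective (ℕ.suc-injective (trans (sym e) e′))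
  Next-injective (inj₁ e)       (inj₂ (_ , e′)) = ⊥-elim (ℕ.0≢1+n (trans (sym e′) e))
  Next-injective (inj₂ (_ , e)) (inj₁ e′)      = ⊥-elim (ℕ.0≢1+n (trans (sym e) e′))
  Next-injective (inj₂ (e , _)) (inj₂ (e′ , _)) = Fin.toℕ-injective (ℕ.suc-injective (trans e (sym e′)))

  orientation : ∀ {a b d} → CycAdj G a b → CycAdj G b d → a ≢ d →
                (Next a b × Next b d) ⊎ (Next d b × Next b a)
  orientation (inj₁ ab) (inj₁ bd) _   = inj₁ (ab , bd)
  orientation (inj₁ ab) (inj₂ db) a≢d = ⊥-elim (a≢d (Next-injective ab db))
  orientation (inj₂ ba) (inj₁ bd) a≢d = ⊥-elim (a≢d (Next-functional ba bd))
  orientation (inj₂ ba) (inj₂ db) _   = inj₂ (db , ba)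

  CycAdj-middle : ∀ {a b d m} → CycAdj G a b → CycAdj G b d → a ≢ d → CycAdj G b m → m ≡ a ⊎ m ≡ d
  CycAdj-middle ab bd a≢d bm with orientation ab bd a≢d | bm
  ... | inj₁ (a→b , b→d) | inj₁ b→m = inj₂ (Next-functional b→m b→d)
  ... | inj₁ (a→b , b→d) | inj₂ m→b = inj₁ (Next-injective m→b a→b)
  ... | inj₂ (d→b , b→a) | inj₁ b→m = inj₁ (Next-functional b→m b→a)
  ... | inj₂ (d→b , b→a) | inj₂ m→b = inj₂ (Next-injective m→b d→b)

  no-triangle : ∀ {a b d} → Next a b → Next b d → Next d a → ⊥
  no-triangle (inj₁ e₁) (inj₁ e₂) (inj₁ e₃) =
    ℕ.m≢1+n+m _ {2} (trans e₃ (cong suc (trans e₂ (cong suc e₁))))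
  no-triangle (inj₁ e₁) (inj₁ e₂) (inj₂ (e₃ , e₄)) =
    k≢ (trans (sym e₃) (cong suc (trans e₂ (cong suc (trans e₁ (cong suc e₄)))))) (ℕ.n<1+n 3)
  no-triangle (inj₁ e₁) (inj₂ (e₂ , e₃)) (inj₁ e₄) =
    k≢ (trans (sym e₂) (cong suc (trans e₁ (cong suc (trans e₄ (cong suc e₃)))))) (ℕ.n<1+n 3)
  no-triangle (inj₂ (e₁ , e₂)) (inj₁ e₃) (inj₁ e₄) =
    k≢ (trans (sym e₁) (cong suc (trans e₄ (cong suc (trans e₃ (cong suc e₂)))))) (ℕ.n<1+n 3)
  no-triangle (inj₂ (_ , e₂)) (inj₂ (e₃ , _)) _ = k≢ (trans (sym e₃) (cong suc e₂)) (s≤s (s≤s z≤n))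
  no-triangle (inj₂ (e₁ , _)) (inj₁ _) (inj₂ (_ , e₆)) = k≢ (trans (sym e₁) (cong suc e₆)) (s≤s (s≤s z≤n))
  no-triangle (inj₁ _) (inj₂ (_ , e₄)) (inj₂ (e₅ , _)) = k≢ (trans (sym e₅) (cong suc e₄)) (s≤s (s≤s z≤n))

  ends-not-CycAdj : ∀ {a b d} → CycAdj G a b → CycAdj G b d → a ≢ d → b ≢ a → b ≢ d → ¬ CycAdj G a d
  ends-not-CycAdj ab bd a≢d b≢a b≢d ad with orientation ab bd a≢d | ad
  ... | inj₁ (a→b , b→d) | inj₁ a→d = b≢d (Next-functional a→b a→d)
  ... | inj₁ (a→b , b→d) | inj₂ d→a = no-triangle a→b b→d d→a
  ... | inj₂ (d→b , b→a) | inj₁ a→d = no-triangle d→b b→a a→d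
  ... | inj₂ (d→b , b→a) | inj₂ d→a = b≢a (Next-functional d→b d→a)

  ArcPos⇒≢ : ∀ side {i j m} → Arc side i j m → m ≢ i × m ≢ j
  ArcPos⇒≢ true  (inj₁ (i<m , m<j)) = (λ { refl → ℕ.<-irrefl refl i<m }) , (λ { refl → ℕ.<-irrefl refl m<j })
  ArcPos⇒≢ true  (inj₂ (j<m , m<i)) = (λ { refl → ℕ.<-irrefl refl m<i }) , (λ { refl → ℕ.<-irrefl refl j<m })
  ArcPos⇒≢ false (inj₁ (m<i , m<j)) = (λ { refl → ℕ.<-irrefl refl m<i }) , (λ { refl → ℕ.<-irrefl refl m<j })
  ArcPos⇒≢ false (inj₂ (i<m , j<m)) = (λ { refl → ℕ.<-irrefl refl i<m }) , (λ { refl → ℕ.<-irrefl refl j<m })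

  private
    inside-not-outside : ∀ {i j m} → Arc true i j m → ¬ Arc false i j m
    inside-not-outside (inj₁ (i<m , _)) (inj₁ (m<i , _)) = ℕ.<-asym i<m m<i
    inside-not-outside (inj₁ (_ , m<j)) (inj₂ (_ , j<m)) = ℕ.<-asym m<j j<m
    inside-not-outside (inj₂ (j<m , _)) (inj₁ (_ , m<j)) = ℕ.<-asym j<m m<j
    inside-not-outside (inj₂ (_ , m<i)) (inj₂ (i<m , _)) = ℕ.<-asym m<i i<m

  ArcPos-disjoint : ∀ side {i j m} → Arc side i j m → ¬ Arc (not side) i j m
  ArcPos-disjoint true  p q = inside-not-outside p q
  ArcPos-disjoint false p q = inside-not-outside q p

  ArcPos-sym : ∀ side {i j m} → Arc side i j m → Arc side j i m
  ArcPos-sym true  = Sum.swap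
  ArcPos-sym false = Sum.map Product.swap Product.swap

  private
    pred-positive : ∀ {a} → suc a ≡ k → 0 ℕ.< a
    pred-positive {zero}  1≡k = ⊥-elim (k≢ (sym 1≡k) (s≤s (s≤s z≤n)))
    pred-positive {suc _} _   = s≤s z≤n

    squeeze : ∀ {a b m} → b ≡ suc a → a ℕ.< m → m ℕ.< suc b → m ≡ b
    squeeze refl a<m (s≤s m≤b) = ℕ.≤-antisym m≤b a<m

    <-of-suc : ∀ {a b} → b ≡ suc a → a ℕ.< b
    <-of-suc refl = ℕ.≤-refl

    arc-of-next : ∀ {a b d} → Next a b → Next b d →
                  Σ Bool λ side → Arc side a d b × (∀ m → Arc side a d m → m ≡ b)
    arc-of-next {a} {b} {d} (inj₁ b≡1+a) (inj₁ d≡1+b) = true , inj₁ (<-of-suc b≡1+a , <-of-suc d≡1+b) , only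
      where
      only : ∀ m → Arc true a d m → m ≡ b
      only m (inj₁ (a<m , m<d)) = Fin.toℕ-injective (squeeze b≡1+a a<m (subst (toℕ m ℕ.<_) d≡1+b m<d))
      only m (inj₂ (d<m , m<a)) =
        ⊥-elim (ℕ.<-asym (ℕ.<-trans d<m m<a) (ℕ.<-trans (<-of-suc b≡1+a) (<-of-suc d≡1+b)))
    arc-of-next {a} {b} {d} (inj₁ b≡1+a) (inj₂ (1+b≡k , d≡0)) =
      false , inj₂ (<-of-suc b≡1+a , subst (ℕ._< toℕ b) (sym d≡0) (subst (0 ℕ.<_) (sym b≡1+a) (s≤s z≤n))) , only
      where
      only : ∀ m → Arc false a d m → m ≡ b
      only m (inj₁ (_ , m<d)) with subst (toℕ m ℕ.<_) d≡0 m<d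
      ... | ()
      only m (inj₂ (a<m , _)) =
        Fin.toℕ-injective (squeeze b≡1+a a<m (subst (toℕ m ℕ.<_) (sym 1+b≡k) (Fin.toℕ<n m)))
    arc-of-next {a} {b} {d} (inj₂ (1+a≡k , b≡0)) (inj₁ d≡1+b) =
      false , inj₁ (subst (ℕ._< toℕ a) (sym b≡0) (pred-positive 1+a≡k) , <-of-suc d≡1+b) , only
      where
      only : ∀ m → Arc false a d m → m ≡ b
      only m (inj₁ (_ , m<d)) =
        Fin.toℕ-injective (trans (ℕ.n<1⇒n≡0 (subst (toℕ m ℕ.<_) (trans d≡1+b (cong suc b≡0)) m<d)) (sym b≡0))
      only m (inj₂ (a<m , _)) =
        ⊥-elim (ℕ.<-irrefl refl (ℕ.<-≤-trans a<m (ℕ.≤-pred (subst (toℕ m ℕ.<_) (sym 1+a≡k) (Fin.toℕ<n m)))))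
    arc-of-next (inj₂ (_ , b≡0)) (inj₂ (1+b≡k , _)) = ⊥-elim (k≢ (trans (sym 1+b≡k) (cong suc b≡0)) (s≤s (s≤s z≤n)))

  arc-of-middle : ∀ {a b d} → CycAdj G a b → CycAdj G b d → a ≢ d →
                  Σ Bool λ side → Arc side a d b × (∀ m → Arc side a d m → m ≡ b)
  arc-of-middle ab bd a≢d with orientation ab bd a≢d
  ... | inj₁ (a→b , b→d) = arc-of-next a→b b→d
  ... | inj₂ (d→b , b→a) =
    let side , b∈ , only = arc-of-next d→b b→a in
    side , ArcPos-sym side b∈ , (λ m m∈ → only m (ArcPos-sym side m∈))

module Hole {n : ℕ} (G : Graph n) {k : ℕ} (c : Fin k → Fin n) (hole : IsHole G k c)
  (one : ∀ v → ¬ OnHole G c v → ∀ i j → i ≢ j → ¬ (Adj G v (c i) × Adj G v (c j))) where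
  open Walks G
  open InducedPaths G
  open Cycle G (proj₁ hole)
  open import Data.List.Membership.DecPropositional (Fin._≟_ {k}) using (_∈?_)

  OnHole? : Decidable (OnHole G c)
  OnHole? v = Fin.any? (λ m → c m Fin.≟ v)

  c-injective : ∀ {i j} → c i ≡ c j → i ≡ j
  c-injective = proj₁ (proj₂ hole) _ _

  Adj⇒CycAdj : ∀ {i j} → Adj G (c i) (c j) → CycAdj G i j
  Adj⇒CycAdj = Equivalence.to (proj₂ (proj₂ hole) _ _)

  CycAdj⇒Adj : ∀ {i j} → CycAdj G i j → Adj G (c i) (c j)
  CycAdj⇒Adj = Equivalence.from (proj₂ (proj₂ hole) _ _)

  touch-unique : ∀ {v i j} → ¬ OnHole G c v → Adj G v (c i) → Adj G v (c j) → i ≡ j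
  touch-unique {v} {i} {j} v∉C vi vj = decidable-stable (i Fin.≟ j) λ i≢j → one v v∉C i j i≢j (vi , vj)

  -- A walk avoiding Dirty S shortcuts to a jump whose interior sees C only within S.
  Dirty : List (Fin k) → Pred (Fin n) 0ℓ
  Dirty S v = OnHole G c v ⊎ Σ (Fin k) λ j → j ∉ S × Adj G v (c j)

  Dirty? : ∀ S → Decidable (Dirty S)
  Dirty? S v = OnHole? v ⊎-dec Fin.any? (λ j → ¬? (j ∈? S) ×-dec Adj? v (c j))

  Dirty-anti : ∀ {S S′} → (_∈ S) ⊆ (_∈ S′) → Dirty S′ ⊆ Dirty S
  Dirty-anti S⊆S′ (inj₁ v∈C)            = inj₁ v∈C
  Dirty-anti S⊆S′ (inj₂ (j , j∉S′ , vj)) = inj₂ (j , j∉S′ ∘ S⊆S′ , vj)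

  clean-touching : ∀ {S v j} → ¬ OnHole G c v → Adj G v (c j) → j ∈ S → ¬ Dirty S v
  clean-touching v∉C vj j∈S (inj₁ v∈C)            = v∉C v∈C
  clean-touching v∉C vj j∈S (inj₂ (i , i∉S , vi)) with touch-unique v∉C vj vi
  ... | refl = i∉S j∈S

  clean⇒∉hole : ∀ {S v} → ¬ Dirty S v → ¬ OnHole G c v
  clean⇒∉hole clean = clean ∘ inj₁

  clean-drop : ∀ {j S v} → ¬ Dirty (j ∷ S) v → ¬ Adj G v (c j) → ¬ Dirty S v
  clean-drop clean ¬vj (inj₁ v∈C) = clean (inj₁ v∈C)
  clean-drop {j} clean ¬vj (inj₂ (i , i∉S , vi)) with i Fin.≟ j
  ... | yes refl = ¬vj vi
  ... | no  i≢j  = clean (inj₂ (i , All¬⇒¬Any (i≢j All.∷ ¬Any⇒All¬ _ i∉S) , vi))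

  clean⇒∈ : ∀ {S v j} → ¬ Dirty S v → Adj G v (c j) → j ∈ S
  clean⇒∈ {S} {j = j} clean vj = decidable-stable (j ∈? S) λ j∉S → clean (inj₂ (j , j∉S , vj))

  lastTouch : ∀ {S u v} → Reach G (Dirty S) u v → Σ (Fin k) (λ a → Adj G u (c a)) →
              Σ (Fin n) λ q → Σ (Fin k) λ a →
                Adj G q (c a) × Reach G (Dirty S) u q × Reach G (Dirty (a ∷ [])) q v
  lastTouch (here clean) (a , ua) =
    _ , a , ua , here clean , here (clean-touching (clean⇒∉hole clean) ua (here refl))
  lastTouch r@(step {w = v} r′ clean v′v) touch with Fin.any? (λ a → Adj? v (c a))
  ... | yes (a , va) = v , a , va , r , here (clean-touching (clean⇒∉hole clean) va (here refl))
  ... | no ¬touch =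
    let q , a , qa , pre , tail = lastTouch r′ touch in
    q , a , qa , pre , step tail (λ { (inj₁ v∈C) → clean (inj₁ v∈C) ; (inj₂ (j , _ , vj)) → ¬touch (j , vj) }) v′v

  Bridge : List (Fin k) → Fin k → Fin k → Set
  Bridge S s t = Σ (Fin n) λ a → Σ (Fin n) λ b → Adj G (c s) a × Reach G (Dirty S) a b × Adj G b (c t)

  Bridge-sym : ∀ {S s t} → Bridge S s t → Bridge S t s
  Bridge-sym (a , b , sa , r , bt) = b , a , Adj-sym bt , reverse r , Adj-sym sa

  Bridge-mono : ∀ {S S′ s t} → (_∈ S) ⊆ (_∈ S′) → Bridge S s t → Bridge S′ s t
  Bridge-mono S⊆S′ (a , b , sa , r , bt) = a , b , sa , relax (Dirty-anti S⊆S′) r , bt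

  bridgePath : ∀ {S s t} → s ≢ t → Bridge S s t →
               Σ (List (Fin n)) λ mid → Induced (c s ∷ mid ++ c t ∷ []) × All (¬_ ∘ Dirty S) mid
  bridgePath {S} {s} {t} s≢t (a , b , sa , r , bt) =
    let mid , ind , allowed = inducedPath walk (s≢t ∘ c-injective) in
    mid , ind , All.zipWith (λ (¬X , ≢s , ≢t) d → ¬X (d , ≢s , ≢t)) (allowed , interior-≢ends ind)
    where
    X : Pred (Fin n) 0ℓ
    X v = Dirty S v × v ≢ c s × v ≢ c t
    walk : Reach G X (c s) (c t)
    walk = prepend sa (λ (_ , ≢s , _) → ≢s refl) (step (relax proj₁ r) (λ (_ , _ , ≢t) → ≢t refl) bt)

  JumpWith : Fin k → Fin k → (∀ {len} → (Fin (suc len) → Fin n) → Set) → Set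
  JumpWith s t P = Σ ℕ λ len → Σ (Fin (suc len) → Fin n) λ p → IsJump G c s t p × P p

  private
    path : ∀ s mid t → Fin (length (c s ∷ mid ++ c t ∷ [])) → Fin n
    path s mid t = lookup (c s ∷ mid ++ c t ∷ [])

    jump : ∀ {s t mid} → s ≢ t → ¬ Adj G (c s) (c t) → Induced (c s ∷ mid ++ c t ∷ []) →
           All (¬_ ∘ OnHole G c) mid → IsJump G c s t (path s mid t)
    jump {s} {t} {mid} s≢t ¬st ind off =
      s≢t , ¬st , Induced⇒IsInducedPath ind , refl , lookup-last (c s) mid (c t) ,
      λ v v∈P → All.lookup off (Equivalence.to (PathInt⇔∈ (c s) mid (c t) v) v∈P)

    anticomplete : ∀ {S s t mid} side → All (¬_ ∘ Dirty S) mid → (∀ m → ArcPos G side s t m → m ∉ S) →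
                   AntiComplete G (ArcInt G c side s t) (PathInt G (path s mid t))
    anticomplete {s = s} {t} {mid} side clean outside _ v (m , m∈ , refl) v∈P mv =
      outside m m∈ (clean⇒∈ (All.lookup clean (Equivalence.to (PathInt⇔∈ (c s) mid (c t) v) v∈P)) (Adj-sym mv))

    short : ∀ {s t mid} → All (¬_ ∘ Dirty (s ∷ t ∷ [])) mid → IsShort G c s t (path s mid t)
    short clean = anticomplete true clean (outside true) , anticomplete false clean (outside false)
      where
      outside : ∀ {s t} side m → ArcPos G side s t m → m ∉ s ∷ t ∷ []
      outside side m m∈ = let m≢s , m≢t = ArcPos⇒≢ side m∈ in All¬⇒¬Any (m≢s All.∷ m≢t All.∷ All.[])

  shortJump : ∀ {s t} → s ≢ t → ¬ Adj G (c s) (c t) → Bridge (s ∷ t ∷ []) s t → JumpWith s t (IsShort G c s t)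
  shortJump {s} {t} s≢t ¬st bridge =
    let mid , ind , clean = bridgePath s≢t bridge in
    _ , path s mid t , jump s≢t ¬st ind (All.map clean⇒∉hole clean) , short clean

  localJump : ∀ {s t y₀} side → s ≢ t → ¬ Adj G (c s) (c t) →
              ArcPos G side s t y₀ → (∀ m → ArcPos G side s t m → m ≡ y₀) →
              Bridge (y₀ ∷ s ∷ t ∷ []) s t →
              JumpWith s t (λ p → IsShort G c s t p ⊎ IsLocalAcrossVertex G c (c y₀) s t p)
  localJump {s} {t} {y₀} side s≢t ¬st y₀∈ only bridge with bridgePath s≢t bridge
  ... | mid , ind , clean with Any.any? (λ e → Adj? e (c y₀)) mid
  ...   | no ¬touch =
    _ , path s mid t , jump s≢t ¬st ind (All.map clean⇒∉hole clean) ,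
    inj₁ (short (All.zipWith (uncurry′ clean-drop) (clean , ¬Any⇒All¬ mid ¬touch)))
  ...   | yes touch =
    _ , path s mid t , jump s≢t ¬st ind (All.map clean⇒∉hole clean) , inj₂ (side , arc≡y₀ , touched , other)
    where
    arc≡y₀ : ∀ v → ArcInt G c side s t v ⇔ v ≡ c y₀
    arc≡y₀ v = mk⇔ (λ { (m , m∈ , refl) → cong c (only m m∈) }) (λ { refl → y₀ , y₀∈ , refl })
    touched : ¬ AntiComplete G (ArcInt G c side s t) (PathInt G (path s mid t))
    touched anti = let e , e∈ , ey₀ = find touch in
      anti (c y₀) e (y₀ , y₀∈ , refl) (Equivalence.from (PathInt⇔∈ (c s) mid (c t) e) e∈) (Adj-sym ey₀)
    other : AntiComplete G (ArcInt G c (not side) s t) (PathInt G (path s mid t))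
    other = anticomplete (not side) clean λ m m∈ →
      let m≢s , m≢t = ArcPos⇒≢ (not side) m∈ in
      All¬⇒¬Any ((λ { refl → ArcPos-disjoint side y₀∈ m∈ }) All.∷ m≢s All.∷ m≢t All.∷ All.[])

module ThreeVertexPath {n : ℕ} (G : Graph n) {k : ℕ} (c : Fin k → Fin n) (hole : IsHole G k c)
  (one : ∀ v → ¬ OnHole G c v → ∀ i j → i ≢ j → ¬ (Adj G v (c i) × Adj G v (c j)))
  (deg : ∀ v → degree G v ≢ 2) (noK2 : ∀ u v → ¬ K2Cut G u v)
  {x y z : Fin k} (xy : CycAdj G x y) (yz : CycAdj G y z) (x≢z : x ≢ z) where
  open Walks G
  open Cycle G (proj₁ hole)
  open Hole G c hole one
  open import Data.List.Membership.DecPropositional (Fin._≟_ {k}) using (_∈?_)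

  EndOfShortJump : Fin k → Set
  EndOfShortJump e = EndOfJumpWith G c e (IsShort G c)

  EndOfShortOrLocalJump : Fin k → Set
  EndOfShortOrLocalJump e =
    EndOfJumpWith G c e (λ i j p → IsShort G c i j p ⊎ Σ (Fin n) λ w → IsLocalAcrossVertex G c w i j p)

  LocalJumpAcrossY : Set
  LocalJumpAcrossY = Σ ℕ λ len → Σ (Fin (suc len) → Fin n) λ p →
    (IsJump G c x z p ⊎ IsJump G c z x p) × IsLocalAcrossVertex G c (c y) x z p

  Conclusion : Set
  Conclusion = (EndOfShortJump x ⊎ EndOfShortJump z) ⊎ LocalJumpAcrossY ⊎ EndOfShortOrLocalJump y

  S₃ : List (Fin k)
  S₃ = y ∷ x ∷ z ∷ []

  swap-last : ∀ {a b} → (_∈ y ∷ a ∷ b ∷ []) ⊆ (_∈ y ∷ b ∷ a ∷ [])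
  swap-last (here e)                 = here e
  swap-last (there (here e))         = there (there (here e))
  swap-last (there (there (here e))) = there (here e)

  y≢x : y ≢ x
  y≢x y≡x = Adj⇒≢ (CycAdj⇒Adj xy) (cong c (sym y≡x))

  y≢z : y ≢ z
  y≢z y≡z = Adj⇒≢ (CycAdj⇒Adj yz) (cong c y≡z)

  bridgeXZ⇒Conclusion : Bridge S₃ x z → Conclusion
  bridgeXZ⇒Conclusion bridge with arc-of-middle xy yz x≢z
  ... | side , y∈ , only with localJump side x≢z ¬xz y∈ only bridge
    where
    ¬xz : ¬ Adj G (c x) (c z)
    ¬xz xz = ends-not-CycAdj xy yz x≢z y≢x y≢z (Adj⇒CycAdj xz)
  ...   | len , p , jump , inj₁ short = inj₁ (inj₁ (x , z , len , p , inj₁ refl , jump , short))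
  ...   | len , p , jump , inj₂ local = inj₂ (inj₁ (len , p , inj₁ jump , local))

  offHoleNeighbour : Σ (Fin n) λ w → Adj G (c y) w × ¬ OnHole G c w
  offHoleNeighbour with Fin.any? (λ w → Adj? (c y) w ×-dec ¬? (OnHole? w))
  ... | yes found = found
  ... | no  none  = ⊥-elim (deg (c y) (↭-length (∼bag⇒↭ (unique∧set⇒bag unique-neighbours unique-xz same))))
    where
    neighbours : List (Fin n)
    neighbours = filter (Adj? (c y)) (allFin n)
    unique-neighbours : Unique neighbours
    unique-neighbours = filter⁺ (Adj? (c y)) (allFin⁺ n)
    unique-xz : Unique (c x ∷ c z ∷ [])
    unique-xz = ((x≢z ∘ c-injective) ∷ []) AllPairs.∷ [] AllPairs.∷ AllPairs.[]
    same : neighbours ∼[ set ] (c x ∷ c z ∷ [])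
    same {v} = mk⇔ to from
      where
      to : v ∈ neighbours → v ∈ c x ∷ c z ∷ []
      to v∈ with OnHole? v | proj₂ (∈-filter⁻ (Adj? (c y)) {xs = allFin n} v∈)
      ... | no  v∉C      | yv = ⊥-elim (none (v , yv , v∉C))
      ... | yes (m , refl) | yv with CycAdj-middle xy yz x≢z (Adj⇒CycAdj yv)
      ...   | inj₁ refl = here refl
      ...   | inj₂ refl = there (here refl)
      from : v ∈ c x ∷ c z ∷ [] → v ∈ neighbours
      from (here refl)         = ∈-filter⁺ (Adj? (c y)) (∈-allFin _) (Adj-sym (CycAdj⇒Adj xy))
      from (there (here refl)) = ∈-filter⁺ (Adj? (c y)) (∈-allFin _) (CycAdj⇒Adj yz)

  w : Fin n
  w = proj₁ offHoleNeighbour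

  yw : Adj G (c y) w
  yw = proj₁ (proj₂ offHoleNeighbour)

  w∉C : ¬ OnHole G c w
  w∉C = proj₂ (proj₂ offHoleNeighbour)

  w-clean : ¬ Dirty S₃ w
  w-clean = clean-touching w∉C (Adj-sym yw) (here refl)

  Escape : Set
  Escape = Σ (Fin n) λ v → Reach G (Dirty S₃) w v × Σ (Fin n) λ v′ → Adj G v v′ × ¬ OnHole G c v′ ×
           Σ (Fin k) λ u → u ∉ S₃ × Adj G v′ (c u)

  Escape? : Dec Escape
  Escape? = Fin.any? λ v → reach? (Dirty? S₃) w v ×-dec Fin.any? λ v′ → Adj? v v′ ×-dec ¬? (OnHole? v′) ×-dec
            Fin.any? λ u → ¬? (u ∈? S₃) ×-dec Adj? v′ (c u)

  module NoEscape (¬escape : ¬ Escape) where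

    confined : ∀ {v} → Reach G (OnHole G c) w v → Reach G (Dirty S₃) w v
    confined (here _) = here w-clean
    confined (step r v′∉C vv′) = step (confined r) clean vv′
      where
      clean : ¬ Dirty S₃ _
      clean (inj₁ v′∈C)            = v′∉C v′∈C
      clean (inj₂ (u , u∉ , v′u)) = ¬escape (_ , confined r , _ , vv′ , v′∉C , u , u∉ , v′u)

    -- The edge c a – c y is not a K₂-cut, so w reaches c b avoiding it; the vertex before the
    -- first hole vertex on that walk lies in the component of w and must see c b.
    attach : ∀ {a b} → (_∈ S₃) ⊆ (_∈ y ∷ a ∷ b ∷ []) → CycAdj G a y → b ≢ a → b ≢ y →
             Σ (Fin n) λ v → Reach G (Dirty S₃) w v × Adj G v (c b)
    attach {a} {b} S₃⊆ ay b≢a b≢y with firstEntry OnHole? w∉C walk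
      where
      Cut : Fin n → Set
      Cut v = v ≡ c a ⊎ v ≡ c y
      walk : Reach G Cut w (c b)
      walk = decidable-stable (reach? (λ v → (v Fin.≟ c a) ⊎-dec (v Fin.≟ c y)) w (c b)) λ ¬walk →
        noK2 (c a) (c y) (CycAdj⇒Adj ay , w , c b ,
          (λ { (inj₁ w≡a) → w∉C (a , sym w≡a) ; (inj₂ w≡y) → w∉C (y , sym w≡y) }) ,
          (λ { (inj₁ e) → b≢a (c-injective e) ; (inj₂ e) → b≢y (c-injective e) }) , ¬walk)
    ... | inj₁ avoid = ⊥-elim (end-allowed avoid (inj₂ (b , refl)))
    ... | inj₂ (v , _ , r , vh , (m , refl) , cm∉Cut) with S₃⊆ (clean⇒∈ (end-allowed (confined (relax inj₂ r))) vh)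
    ...   | here refl                 = ⊥-elim (cm∉Cut (inj₂ refl))
    ...   | there (here refl)         = ⊥-elim (cm∉Cut (inj₁ refl))
    ...   | there (there (here refl)) = v , confined (relax inj₂ r) , vh

    bridge : Bridge S₃ x z
    bridge =
      let v₁ , r₁ , v₁z = attach (λ m∈ → m∈) xy (≢-sym x≢z) (≢-sym y≢z)
          v₂ , r₂ , v₂x = attach swap-last (CycAdj-sym yz) x≢z (≢-sym y≢x)
      in v₂ , v₁ , Adj-sym v₂x , concat (reverse r₂) r₁ , v₁z

  jumpFromY⇒End : ∀ {u v} → JumpWith y u (λ p → IsShort G c y u p ⊎ IsLocalAcrossVertex G c v y u p) →
                  EndOfShortOrLocalJump y
  jumpFromY⇒End (len , p , jump , inj₁ short) = y , _ , len , p , inj₁ refl , jump , inj₁ short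
  jumpFromY⇒End (len , p , jump , inj₂ local) = y , _ , len , p , inj₁ refl , jump , inj₂ (_ , local)

  shortJump⇒Conclusion : ∀ {a u} → a ∈ S₃ → JumpWith a u (IsShort G c a u) → Conclusion
  shortJump⇒Conclusion (here refl) (len , p , jump , short) =
    inj₂ (inj₂ (_ , _ , len , p , inj₁ refl , jump , inj₁ short))
  shortJump⇒Conclusion (there (here refl)) (len , p , jump , short) =
    inj₁ (inj₁ (_ , _ , len , p , inj₁ refl , jump , short))
  shortJump⇒Conclusion (there (there (here refl))) (len , p , jump , short) =
    inj₁ (inj₂ (_ , _ , len , p , inj₁ refl , jump , short))

  -- The case where the last vertex q of the escaping walk that sees C sees c a, with a ∈ {x, z}
  -- adjacent to u on C; b is the other end of xyz.
  module Adjacent {a b} (ay : CycAdj G a y) (yb : CycAdj G y b) (a≢b : a ≢ b)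
    {u} (u∉ : u ∉ y ∷ a ∷ b ∷ []) (au : Adj G (c a) (c u))
    {q v′} (qa : Adj G q (c a)) (pre : Reach G (Dirty (y ∷ a ∷ b ∷ [])) w q)
    (tail : Reach G (Dirty (a ∷ u ∷ [])) q v′) (v′u : Adj G v′ (c u)) where

    y≢u : y ≢ u
    y≢u y≡u = u∉ (here (sym y≡u))

    ¬yu : ¬ Adj G (c y) (c u)
    ¬yu yu with CycAdj-middle ay yb a≢b (Adj⇒CycAdj yu)
    ... | inj₁ u≡a = u∉ (there (here u≡a))
    ... | inj₂ u≡b = u∉ (there (there (here u≡b)))

    ¬qb : ¬ Adj G q (c b)
    ¬qb qb = a≢b (touch-unique (clean⇒∉hole (end-allowed pre)) qa qb)

    skip-b : Dirty (a ∷ y ∷ u ∷ []) ⊆ (Dirty (y ∷ a ∷ b ∷ []) ∪ (λ e → Adj G e (c b)))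
    skip-b (inj₁ e∈C) = inj₁ (inj₁ e∈C)
    skip-b {e} (inj₂ (j , j∉ , ej)) with j Fin.≟ b
    ... | yes refl = inj₂ ej
    ... | no  j≢b  = inj₁ (inj₂ (j , All¬⇒¬Any ((j∉ ∘ there ∘ here) ∷ (j∉ ∘ here) ∷ j≢b ∷ []) , ej))

    bridge-or-local : Bridge (y ∷ a ∷ b ∷ []) a b ⊎ EndOfShortOrLocalJump y
    bridge-or-local with firstEntry (λ e → Adj? e (c b)) ¬qb (reverse pre)
    ... | inj₂ (e , f , r , ef , fb , f-clean) = inj₁ (q , f , Adj-sym qa , step (relax inj₁ r) f-clean ef , fb)
    ... | inj₁ avoid with arc-of-middle (CycAdj-sym ay) (Adj⇒CycAdj au) y≢u
    ...   | side , a∈ , only = inj₂ (jumpFromY⇒End (localJump side y≢u ¬yu a∈ only bridge))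
      where
      bridge : Bridge (a ∷ y ∷ u ∷ []) y u
      bridge = w , v′ , yw , concat (reverse (relax skip-b avoid)) (relax (Dirty-anti ⊆) tail) , v′u
        where
        ⊆ : (_∈ a ∷ u ∷ []) ⊆ (_∈ a ∷ y ∷ u ∷ [])
        ⊆ (here e)         = here e
        ⊆ (there (here e)) = there (there (here e))

  lastTouch⇒Conclusion : ∀ {u q v′ a} → u ∉ S₃ → Adj G q (c a) → Reach G (Dirty S₃) w q →
                  Reach G (Dirty (a ∷ u ∷ [])) q v′ → Adj G v′ (c u) → Conclusion
  lastTouch⇒Conclusion {u} {q} {v′} {a} u∉ qa pre tail v′u with clean⇒∈ (end-allowed pre) qa | Adj? (c a) (c u)
  ... | a∈S₃ | no ¬au = shortJump⇒Conclusion a∈S₃ (shortJump a≢u ¬au (q , v′ , Adj-sym qa , tail , v′u))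
    where
    a≢u : a ≢ u
    a≢u a≡u = u∉ (subst (_∈ S₃) a≡u a∈S₃)
  ... | here refl | yes yu with CycAdj-middle xy yz x≢z (Adj⇒CycAdj yu)
  ...   | inj₁ u≡x = ⊥-elim (u∉ (there (here u≡x)))
  ...   | inj₂ u≡z = ⊥-elim (u∉ (there (there (here u≡z))))
  lastTouch⇒Conclusion u∉ qa pre tail v′u | there (here refl) | yes xu
    with Adjacent.bridge-or-local xy yz x≢z u∉ xu qa pre tail v′u
  ... | inj₁ bridge = bridgeXZ⇒Conclusion bridge
  ... | inj₂ end    = inj₂ (inj₂ end)
  lastTouch⇒Conclusion u∉ qa pre tail v′u | there (there (here refl)) | yes zu
    with Adjacent.bridge-or-local (CycAdj-sym yz) (CycAdj-sym xy) (≢-sym x≢z) (u∉ ∘ swap-last) zu qa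
                         (relax (Dirty-anti swap-last) pre) tail v′u
  ... | inj₁ bridge = bridgeXZ⇒Conclusion (Bridge-mono swap-last (Bridge-sym bridge))
  ... | inj₂ end    = inj₂ (inj₂ end)

  escape⇒Conclusion : Escape → Conclusion
  escape⇒Conclusion (v , walk , v′ , vv′ , v′∉C , u , u∉S₃ , v′u) =
    let q , a , qa , pre , tail = lastTouch walk (y , Adj-sym yw) in
    lastTouch⇒Conclusion u∉S₃ qa pre
      (step (relax (Dirty-anti (λ { (here e) → here e })) tail) (clean-touching v′∉C v′u (there (here refl))) vv′) v′u

lemma2p5 : ∀ {n : ℕ} (G : Graph n) (k : ℕ) (c : Fin k → Fin n) →
    IsHole G k c →
    (∀ v → ¬ OnHole G c v → ∀ i j → i ≢ j → ¬ (Adj G v (c i) × Adj G v (c j))) →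
    (∀ v → degree G v ≢ 2) →
    (∀ v → ¬ K1Cut G v) →
    (∀ u v → ¬ K2Cut G u v) →
    ∀ (x y z : Fin k) → CycAdj G x y → CycAdj G y z → x ≢ z →
      (EndOfJumpWith G c x (IsShort G c) ⊎ EndOfJumpWith G c z (IsShort G c))
      ⊎ (Σ ℕ λ len → Σ (Fin (suc len) → Fin n) λ p →
           (IsJump G c x z p ⊎ IsJump G c z x p) ×
           IsLocalAcrossVertex G c (c y) x z p)
      ⊎ (EndOfJumpWith G c y (λ i j p → IsShort G c i j p ⊎ Σ (Fin n) λ w → IsLocalAcrossVertex G c w i j p))
lemma2p5 G k c hole one deg _ noK2 x y z xy yz x≢z = case Escape? of λ where
    (yes escape)  → escape⇒Conclusion escape
    (no  ¬escape) → bridgeXZ⇒Conclusion (NoEscape.bridge ¬escape)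
  where open ThreeVertexPath G c hole one deg noK2 xy yz x≢z
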